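{- Let $A$ be an algebra with a fixed basis $\mathcal{B}=\{x_1,\dots,x_n\}$. Then $$\chi(G_R(A)^2)\le \chi(G_R(A))\le \chi(G_R(A)^2)+1,\qquad \chi(G_L(A)^2)\le \chi(G_L(A))\le \chi(G_L(A)^2)+1.$$
   Context: $\mathbb{F}$ is an algebraically closed field of characteristic zero; an algebra is a finite-dimensional $\mathbb{F}$-vector space $A$ with a bilinear product $*$. Write $x_i*x_j=\sum_l c_{ij}^l x_l$. $G_R(A)$ has vertices $x_1,\dots,x_n$ and an arrow $x_i\to x_l$ iff $c_{ij}^l\ne0$ for some $j$; $G_L(A)$ has vertices $x_1,\dots,x_n$ and an arrow $x_j\to x_l$ iff $c_{ij}^l\neq0$ for some $i$. $A^2$ is the subspace spanned by all products $y*z$. Let $W=\{x_k\in\mathcal{B}: \exists\, y\in A^2,\ y=\sum_i\alpha_i x_i \text{ with } \alpha_k\neq 0\}$; $G_R(A)^2$ (resp. $G_L(A)^2$) is the subdigraph of $G_R(A)$ (resp. $G_L(A)$) induced by $W$. The chromatic index $\chi(G)$ of a digraph $G$ is the minimum $m$ such that there is a map $c:V(G)\to\{1,\dots,m\}$ with $c(v)\ne c(w)$ whenever $v$ and $w$ are adjacent (joined by an arrow in either direction). -}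

module Defs where

open import Level using (Level; _⊔_; suc; Lift)
open import Algebra.Bundles using (CommutativeRing)
open import Data.Nat using (ℕ; zero; _≤_) renaming (suc to sucℕ)
open import Data.Fin using (Fin)
open import Data.List using (List; []; _∷_; _++_; [_]; length; foldr)
open import Data.Product using (Σ; ∃; _×_; _,_)
open import Data.Sum using (_⊎_)
open import Data.Unit using (⊤)
open import Relation.Nullary using (¬_)
open import Relation.Binary.PropositionalEquality using (_≡_; _≢_)

record Field (c ℓ : Level) : Set (Level.suc (c ⊔ ℓ)) where
  field
    commRing : CommutativeRing c ℓ
  open CommutativeRing commRing public
  field
    0≉1     : ¬ (0# ≈ 1#)
    inverse : ∀ x → ¬ (x ≈ 0#) → ∃ λ y → x * y ≈ 1#

  natMul : ℕ → Carrier
  natMul zero     = 0#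
  natMul (sucℕ n) = 1# + natMul n

  -- polynomial with coefficient list a₀ ∷ a₁ ∷ … (lowest degree first)
  evalPoly : List Carrier → Carrier → Carrier
  evalPoly cs x = foldr (λ a acc → a + x * acc) 0# cs

record AlgClosedChar0Field (c ℓ : Level) : Set (Level.suc (c ⊔ ℓ)) where
  field
    fld : Field c ℓ
  open Field fld public
  field
    char0      : ∀ n → ¬ (natMul (sucℕ n) ≈ 0#)
    -- every monic polynomial a₀ + a₁x + … + a_{k-1}x^{k-1} + x^k of degree k ≥ 1 has a root
    algClosed  : ∀ (cs : List Carrier) → 1 ≤ length cs →
                 ∃ λ x → evalPoly (cs ++ [ 1# ]) x ≈ 0#

-- An n-dimensional algebra with fixed basis x₁,…,xₙ, given by its
-- structure constants: x_i * x_j = Σ_l c i j l · x_l.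
-- Elements are coordinate vectors Fin n → F, product extended bilinearly.

module AlgebraDefs {c ℓ : Level} (F : AlgClosedChar0Field c ℓ) where
  open AlgClosedChar0Field F

  record Alg (n : ℕ) : Set c where
    field
      const : Fin n → Fin n → Fin n → Carrier

  Vec𝔽 : ℕ → Set c
  Vec𝔽 n = Fin n → Carrier

  sumFin : ∀ {n} → (Fin n → Carrier) → Carrier
  sumFin {zero}   f = 0#
  sumFin {sucℕ n} f = f Fin.zero + sumFin (λ i → f (Fin.suc i))

  module _ {n : ℕ} (A : Alg n) where
    open Alg A

    mul : Vec𝔽 n → Vec𝔽 n → Vec𝔽 n
    mul y z l = sumFin λ i → sumFin λ j → (y i * z j) * const i j l

    -- A² : the subspace spanned by all products y * z, i.e. finite linear
    -- combinations Σ_m β_m (y_m * z_m)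
    combo : List (Carrier × Vec𝔽 n × Vec𝔽 n) → Vec𝔽 n
    combo []                 l = 0#
    combo ((β , y , z) ∷ ts) l = β * mul y z l + combo ts l

    InA² : Vec𝔽 n → Set (c ⊔ ℓ)
    InA² v = ∃ λ ts → ∀ l → v l ≈ combo ts l

    W : Fin n → Set (c ⊔ ℓ)
    W k = ∃ λ y → InA² y × ¬ (y k ≈ 0#)

    ArrowR : Fin n → Fin n → Set ℓ
    ArrowR i l = ∃ λ j → ¬ (const i j l ≈ 0#)

    ArrowL : Fin n → Fin n → Set ℓ
    ArrowL j l = ∃ λ i → ¬ (const i j l ≈ 0#)

-- Vertex colourings of (induced sub)digraphs on vertex set Fin n.
-- The subdigraph induced by the predicate P; P = λ _ → ⊤ is the whole digraph.

module _ {a p : Level} {n : ℕ} where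

  Adjacent : (Fin n → Fin n → Set a) → Fin n → Fin n → Set a
  Adjacent Arr v w = Arr v w ⊎ Arr w v

  Colouring : (P : Fin n → Set p) → (Fin n → Fin n → Set a) → ℕ → Set (a ⊔ p)
  Colouring P Arr m =
    Σ ((v : Fin n) → P v → Fin m) λ col →
      ∀ v w (pv : P v) (pw : P w) → v ≢ w → Adjacent Arr v w → col v pv ≢ col w pw

  IsChromaticIndex : (P : Fin n → Set p) → (Fin n → Fin n → Set a) → ℕ → Set (a ⊔ p)
  IsChromaticIndex P Arr χ = Colouring P Arr χ × (∀ m → Colouring P Arr m → χ ≤ m)

AllVertices : ∀ {p} {n} → Fin n → Set p
AllVertices {p} _ = Lift p ⊤

-- Every arrow c_ij^l ≠ 0 ends in a vertex x_l of W, because x_l occurs in the product x_i * x_j ∈ A².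
-- Hence the vertices outside W are pairwise non-adjacent: a colouring of G(A)² extends to all of
-- G(A) by giving them a single fresh colour, while any colouring of G(A) restricts to G(A)².
module Submission where

open import Defs
open import Level using (Level; _⊔_; lift)
open import Data.Nat using (ℕ; zero; suc)
open import Data.Nat.Properties using (+-comm)
open import Data.Product using (_×_; _,_)
open import Data.Sum using (inj₁; inj₂)
open import Data.Empty using (⊥-elim)
open import Data.Fin using (Fin; inject₁; fromℕ)
  renaming (zero to fzero; suc to fsuc)
open import Data.Fin.Properties using (inject₁-injective; fromℕ≢inject₁; sequence)
open import Data.List using ([]; _∷_)
open import Effect.Monad using (RawMonad)
open import Relation.Nullary using (¬_; yes; no)
open import Relation.Nullary.Decidable using (decidable-stable; ¬¬-excluded-middle)
open import Relation.Nullary.Negation using (¬¬-Monad; ¬¬-map)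
open import Relation.Unary using (Decidable)
open import Function using (_∘_)
open import Relation.Binary.PropositionalEquality as ≡ using (_≡_; subst)

module _ {c ℓ : Level} (F : AlgClosedChar0Field c ℓ) where
  open AlgClosedChar0Field F
  open AlgebraDefs F
  open import Relation.Binary.Reasoning.Setoid setoid

  basis : ∀ {m} → Fin m → Vec𝔽 m
  basis fzero    fzero    = 1#
  basis fzero    (fsuc _) = 0#
  basis (fsuc _) fzero    = 0#
  basis (fsuc k) (fsuc i) = basis k i

  sumFin-cong : ∀ {m} {f g : Fin m → Carrier} → (∀ i → f i ≈ g i) → sumFin f ≈ sumFin g
  sumFin-cong {zero}  f≈g = refl
  sumFin-cong {suc m} f≈g = +-cong (f≈g fzero) (sumFin-cong {m} (f≈g ∘ fsuc))

  sumFin-zero : ∀ {m} → sumFin {m} (λ _ → 0#) ≈ 0#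
  sumFin-zero {zero}  = refl
  sumFin-zero {suc m} = trans (+-identityˡ _) (sumFin-zero {m})

  sumFin-*ˡ : ∀ {m} x (f : Fin m → Carrier) → sumFin (λ i → x * f i) ≈ x * sumFin f
  sumFin-*ˡ {zero}  x f = sym (zeroʳ x)
  sumFin-*ˡ {suc m} x f = trans (+-cong refl (sumFin-*ˡ {m} x _)) (sym (distribˡ x _ _))

  sumFin-basis : ∀ {m} (k : Fin m) (f : Fin m → Carrier) → sumFin (λ i → basis k i * f i) ≈ f k
  sumFin-basis {suc m} fzero f = begin
    1# * f fzero + sumFin (λ i → 0# * f (fsuc i)) ≈⟨ +-cong (*-identityˡ _) (sumFin-cong {m} λ _ → zeroˡ _) ⟩
    f fzero + sumFin {m} (λ _ → 0#)                ≈⟨ +-cong refl (sumFin-zero {m}) ⟩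
    f fzero + 0#                                   ≈⟨ +-identityʳ _ ⟩
    f fzero                                        ∎
  sumFin-basis {suc m} (fsuc k) f =
    trans (+-cong (zeroˡ _) (sumFin-basis k (λ i → f (fsuc i)))) (+-identityˡ _)

  module _ {n : ℕ} (A : Alg n) where
    open Alg A

    mul-basis : ∀ i j l → mul A (basis i) (basis j) l ≈ const i j l
    mul-basis i j l = begin
      sumFin (λ i′ → sumFin (λ j′ → (basis i i′ * basis j j′) * const i′ j′ l))
        ≈⟨ sumFin-cong {n} (λ i′ → sumFin-cong {n} (λ j′ → *-assoc _ _ _)) ⟩
      sumFin (λ i′ → sumFin (λ j′ → basis i i′ * (basis j j′ * const i′ j′ l)))
        ≈⟨ sumFin-cong {n} (λ i′ → sumFin-*ˡ {n} _ _) ⟩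
      sumFin (λ i′ → basis i i′ * sumFin (λ j′ → basis j j′ * const i′ j′ l))
        ≈⟨ sumFin-cong {n} (λ i′ → *-cong refl (sumFin-basis j (λ j′ → const i′ j′ l))) ⟩
      sumFin (λ i′ → basis i i′ * const i′ j l)
        ≈⟨ sumFin-basis i (λ i′ → const i′ j l) ⟩
      const i j l ∎

    mul∈A² : ∀ y z → InA² A (mul A y z)
    mul∈A² y z = (1# , y , z) ∷ [] , λ l → sym (trans (+-identityʳ _) (*-identityˡ _))

    const≉0⇒W : ∀ i j l → ¬ (const i j l ≈ 0#) → W A l
    const≉0⇒W i j l cᵢⱼˡ≉0 =
      mul A (basis i) (basis j) , mul∈A² (basis i) (basis j) ,
      λ xᵢxⱼ≈0 → cᵢⱼˡ≉0 (trans (sym (mul-basis i j l)) xᵢxⱼ≈0)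

    ArrowR-target∈W : ∀ {i l} → ArrowR A i l → W A l
    ArrowR-target∈W {i} {l} (j , cᵢⱼˡ≉0) = const≉0⇒W i j l cᵢⱼˡ≉0

    ArrowL-target∈W : ∀ {j l} → ArrowL A j l → W A l
    ArrowL-target∈W {j} {l} (i , cᵢⱼˡ≉0) = const≉0⇒W i j l cᵢⱼˡ≉0

-- Imported only here so that it does not clash with the field addition opened above.
open import Data.Nat using (_≤_; _+_; _≤?_)

module _ {a : Level} {n : ℕ} {Arr : Fin n → Fin n → Set a} where

  Colouring-restrict : ∀ {p q} {P : Fin n → Set p} {Q : Fin n → Set q} {m} →
    (∀ {v} → P v → Q v) → Colouring Q Arr m → Colouring P Arr m
  Colouring-restrict P⊆Q (col , proper) =
    (λ v pv → col v (P⊆Q pv)) ,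
    (λ v w pv pw → proper v w (P⊆Q pv) (P⊆Q pw))

  Colouring-extend : ∀ {p} {P : Fin n → Set p} {m} → Decidable P → (∀ {v w} → Arr v w → P w) →
    Colouring P Arr m → Colouring (AllVertices {p}) Arr (suc m)
  Colouring-extend {p} {P} {m} P? target∈P (col , proper) = col′ , proper′
    where
    col′ : (v : Fin n) → AllVertices {p} v → Fin (suc m)
    col′ v _ with P? v
    ... | yes pv = inject₁ (col v pv)
    ... | no _   = fromℕ m

    proper′ : ∀ v w (pv : AllVertices v) (pw : AllVertices w) → ¬ v ≡ w →
      Adjacent {p = p} Arr v w → ¬ col′ v pv ≡ col′ w pw
    proper′ v w _ _ v≢w adj with P? v | P? w
    ... | yes pv | yes pw = proper v w pv pw v≢w adj ∘ inject₁-injective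
    ... | yes _  | no _   = fromℕ≢inject₁ ∘ ≡.sym
    ... | no _   | yes _  = fromℕ≢inject₁
    ... | no ¬pv | no ¬pw with adj
    ...   | inj₁ v→w = ⊥-elim (¬pw (target∈P v→w))
    ...   | inj₂ w→v = ⊥-elim (¬pv (target∈P w→v))

  -- Constructively P need not be decidable, but on the finite vertex set it is so up to double
  -- negation, which suffices because the conclusion χ ≤ χP + 1 is itself decidable.
  ¬¬-decidable : ∀ {p} (P : Fin n → Set p) → ¬ ¬ Decidable P
  ¬¬-decidable P = sequence (RawMonad.rawApplicative ¬¬-Monad) (λ v → ¬¬-excluded-middle)

  chromaticIndex-induced-≤ : ∀ {p q} {P : Fin n → Set p} {Q : Fin n → Set q} {χP χQ} →
    (∀ {v} → P v → Q v) → IsChromaticIndex P Arr χP → IsChromaticIndex Q Arr χQ → χP ≤ χQ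
  chromaticIndex-induced-≤ P⊆Q (_ , minimalP) (colouringQ , _) =
    minimalP _ (Colouring-restrict P⊆Q colouringQ)

  chromaticIndex-≤-suc : ∀ {p} {P : Fin n → Set p} {χ χP} → (∀ {v w} → Arr v w → P w) →
    IsChromaticIndex (AllVertices {p}) Arr χ → IsChromaticIndex P Arr χP → χ ≤ χP + 1
  chromaticIndex-≤-suc {P = P} {χ} {χP} target∈P (_ , minimal) (colouringP , _) =
    decidable-stable (χ ≤? χP + 1) (¬¬-map χ≤χP+1 (¬¬-decidable P))
    where
    χ≤χP+1 : Decidable P → χ ≤ χP + 1
    χ≤χP+1 P? = subst (χ ≤_) (+-comm 1 χP)
      (minimal (suc χP) (Colouring-extend P? target∈P colouringP))

proposition3p4 : ∀ {c ℓ : Level} (F : AlgClosedChar0Field c ℓ) (n : ℕ)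
    (A : AlgebraDefs.Alg F n) →
    (∀ (χR χR² : ℕ) →
    IsChromaticIndex (AllVertices {c ⊔ ℓ}) (AlgebraDefs.ArrowR F A) χR →
    IsChromaticIndex (AlgebraDefs.W F A) (AlgebraDefs.ArrowR F A) χR² →
    χR² ≤ χR × χR ≤ χR² + 1)
    ×
    (∀ (χL χL² : ℕ) →
    IsChromaticIndex (AllVertices {c ⊔ ℓ}) (AlgebraDefs.ArrowL F A) χL →
    IsChromaticIndex (AlgebraDefs.W F A) (AlgebraDefs.ArrowL F A) χL² →
    χL² ≤ χL × χL ≤ χL² + 1)
proposition3p4 F n A =
  (λ _ _ χR χR² → chromaticIndex-induced-≤ (λ _ → lift _) χR² χR ,
                  chromaticIndex-≤-suc (ArrowR-target∈W F A) χR χR²) ,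
  (λ _ _ χL χL² → chromaticIndex-induced-≤ (λ _ → lift _) χL² χL ,
                  chromaticIndex-≤-suc (ArrowL-target∈W F A) χL χL²)
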